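{- Let $G$ be a weighted graph and $T\subseteq G$ a rooted spanning tree of $G$ consisting of a root $r$ and $k$ vertex-disjoint descending paths $P_1,\dots,P_k$. Let $e\in E(P_i)$ and $f\in E(P_j)$ with $i\neq j$. If $\mathrm{Cut}_{T,G}(e,f)<\mathrm{Cut}_{T,G}(g)$ for every $g\in E(T)$, then $\mathrm{CrossCov}(e,f)>\mathrm{CrossCov}(e)/2$.
   Context: Edge weights are positive. A descending path is a path $(v_1,\dots,v_k)$ in the rooted tree with each $v_{i+1}$ a child of $v_i$. For tree edges $e,f$: $\mathrm{Cut}_{T,G}(e)$ is the total weight of edges $\{u,v\}\in E(G)$ whose unique $u$–$v$ path in $T$ contains $e$; $\mathrm{Cut}_{T,G}(e,f)$ is the total weight of edges $\{u,v\}\in E(G)$ whose unique $u$–$v$ path in $T$ contains exactly one of $e,f$. An edge $\{u,v\}\in E(G)$ is a cross-edge if $u\in V(P_a)$ and $v\in V(P_b)$ for some $a\ne b$. For tree edges $e,f$, $\mathrm{CrossCov}(e,f)$ is the total weight of cross-edges $\{u,v\}$ whose unique $u$–$v$ path in $T$ contains both $e$ and $f$, and $\mathrm{CrossCov}(e):=\mathrm{CrossCov}(e,e)$.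
   Formalization: The edge weights of G are positive rationals. -}

module Defs where

open import Data.Nat using (ℕ; suc)
open import Data.Nat.Properties using (_≤?_)
open import Data.Fin using (Fin; toℕ; zero; suc)
open import Data.Fin.Properties using (_≟_)
open import Data.Bool using (Bool; true; false; _∧_; _xor_; not; if_then_else_)
open import Data.List using (List; []; _∷_; map; _++_; concatMap; foldr)
open import Data.List using () renaming (allFin to allFinL)
open import Data.Product using (Σ; _×_; _,_; proj₁; proj₂)
open import Data.Rational using (ℚ; 0ℚ; _+_; _≤_; _<_)
open import Relation.Binary.PropositionalEquality using (_≡_)
open import Relation.Nullary.Decidable using (⌊_⌋)

pairs : {A : Set} → List A → List (A × A)
pairs [] = []
pairs (x ∷ xs) = map (x ,_) xs ++ pairs xs

sumℚ : List ℚ → ℚ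
sumℚ = foldr _+_ 0ℚ

-- The rooted spanning tree T: a root r together with k vertex-disjoint
-- descending paths P_1 … P_k, path P_a having suc (ℓ a) vertices
-- (node a 0 is the top vertex, a child of r; node a (t+1) is a child of node a t).
data Vtx (k : ℕ) (ℓ : Fin k → ℕ) : Set where
  root : Vtx k ℓ
  node : (a : Fin k) → Fin (suc (ℓ a)) → Vtx k ℓ

-- Tree edges of T, identified by their lower (child) endpoint node a t.
TEdge : (k : ℕ) → (Fin k → ℕ) → Set
TEdge k ℓ = Σ (Fin k) (λ a → Fin (suc (ℓ a)))

module _ {k : ℕ} {ℓ : Fin k → ℕ} where

  child : TEdge k ℓ → Vtx k ℓ
  child (a , t) = node a t

  parent : TEdge k ℓ → Vtx k ℓ
  parent (a , zero)  = root
  parent (a , suc t) = node a (Data.Fin.inject₁ t)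

  -- E(P_a): the edges between consecutive vertices of P_a
  -- (edge t joins node a t and node a (t+1)).
  pathEdge : (a : Fin k) → Fin (ℓ a) → TEdge k ℓ
  pathEdge a t = (a , suc t)

  -- u lies in the subtree of T hanging below the tree edge e
  below : TEdge k ℓ → Vtx k ℓ → Bool
  below e root = false
  below (a , t) (node b s) = ⌊ a ≟ b ⌋ ∧ ⌊ toℕ t ≤? toℕ s ⌋

  -- the unique u–v path in T contains the tree edge e
  onPath : TEdge k ℓ → Vtx k ℓ → Vtx k ℓ → Bool
  onPath e u v = below e u xor below e v

  isCross : Vtx k ℓ → Vtx k ℓ → Bool
  isCross (node a _) (node b _) = not ⌊ a ≟ b ⌋
  isCross _ _ = false

  allVtx : List (Vtx k ℓ)
  allVtx = root ∷ concatMap (λ a → map (node a) (allFinL (suc (ℓ a)))) (allFinL k)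


-- A weighted (simple) graph G on the vertex set of T: w u v > 0 iff {u,v} ∈ E(G),
-- in which case w u v is its (positive) weight; w u v = 0 means no edge.
record WGraph (k : ℕ) (ℓ : Fin k → ℕ) : Set where
  field
    w       : Vtx k ℓ → Vtx k ℓ → ℚ
    w-sym   : ∀ u v → w u v ≡ w v u
    w-nonneg : ∀ u v → 0ℚ ≤ w u v
    w-loop  : ∀ v → w v v ≡ 0ℚ

module _ {k : ℕ} {ℓ : Fin k → ℕ} (G : WGraph k ℓ) where
  open WGraph G

  weightOf : (Vtx k ℓ → Vtx k ℓ → Bool) → ℚ
  weightOf P = sumℚ (map (λ uv → if P (proj₁ uv) (proj₂ uv) then w (proj₁ uv) (proj₂ uv) else 0ℚ)
                         (pairs allVtx))

  TreeInGraph : Set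
  TreeInGraph = ∀ (g : TEdge k ℓ) → 0ℚ < w (child g) (parent g)

  Cut₁ : TEdge k ℓ → ℚ
  Cut₁ e = weightOf (λ u v → onPath e u v)

  Cut₂ : TEdge k ℓ → TEdge k ℓ → ℚ
  Cut₂ e f = weightOf (λ u v → onPath e u v xor onPath f u v)

  CrossCov : TEdge k ℓ → TEdge k ℓ → ℚ
  CrossCov e f = weightOf (λ u v → isCross u v ∧ (onPath e u v ∧ onPath f u v))

{-# OPTIONS --safe #-}
module Submission where

-- An edge of G whose tree path contains both e and f joins the
-- subtree below e to the subtree below f; as e and f lie on different paths
-- P_i, P_j, these subtrees are disjoint pieces of P_i and P_j, so the edge is
-- a cross-edge. Counting each edge of G with multiplicity therefore gives
-- Cut(e,f) + 2 CrossCov(e,f) = Cut(e) + Cut(f), while CrossCov(e) <= Cut(e)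
-- trivially. With Cut(e,f) < Cut(f) this yields CrossCov(e) < 2 CrossCov(e,f).

open import Defs
open import Data.Nat using (ℕ)
open import Data.Fin using (Fin)
open import Data.Rational using (ℚ; ½; _*_; _<_)
open import Relation.Binary.PropositionalEquality using (_≢_)

open import Data.Bool using (Bool; true; false; _∧_; _xor_; not; if_then_else_)
open import Data.Bool.Properties using (∧-zeroʳ)
open import Data.Empty using (⊥-elim)
open import Function using (_∘_)
open import Data.Fin.Properties using (_≟_)
open import Data.List using (List; []; _∷_; map)
open import Data.Product using (_×_; _,_; proj₁)
open import Data.Rational using (0ℚ; _+_; _≤_)
open import Data.Rational.Properties
  using ( +-comm; +-identityˡ; +-identityʳ; +-0-commutativeMonoid
        ; *-distribˡ-+; *-distribʳ-+; *-identityˡ; *-monoʳ-<-pos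
        ; ≤-refl; +-mono-≤; +-monoˡ-≤; +-monoˡ-<; <-≤-trans; <-irrefl; ≮⇒≥; _<?_
        ; module ≤-Reasoning )
open import Algebra.Bundles using (CommutativeMonoid)
open import Algebra.Properties.CommutativeSemigroup
  (CommutativeMonoid.commutativeSemigroup +-0-commutativeMonoid) using (interchange)
open import Relation.Binary.PropositionalEquality using (_≡_; refl; sym; trans; cong; cong₂; subst; module ≡-Reasoning)
open import Relation.Nullary using (yes; no)
open import Relation.Nullary.Decidable using (isYes≗does; dec-false)

+-cancelʳ-< : ∀ {p q} r → p + r < q + r → p < q
+-cancelʳ-< {p} {q} r p+r<q+r with p <? q
... | yes p<q = p<q
... | no  p≮q = ⊥-elim (<-irrefl refl (<-≤-trans p+r<q+r (+-monoˡ-≤ r (≮⇒≥ p≮q))))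

½*[p+p]≡p : ∀ p → ½ * (p + p) ≡ p
½*[p+p]≡p p = begin
  ½ * (p + p)     ≡⟨ *-distribˡ-+ ½ p p ⟩
  ½ * p + ½ * p   ≡⟨ sym (*-distribʳ-+ p ½ ½) ⟩
  (½ + ½) * p     ≡⟨ *-identityˡ p ⟩
  p               ∎
  where open ≡-Reasoning

½*p<q : ∀ {p q} → p < q + q → ½ * p < q
½*p<q {p} {q} p<q+q = subst (½ * p <_) (½*[p+p]≡p q) (*-monoʳ-<-pos ½ p<q+q)

module _ {A : Set} where

  sumℚ-map-+ : (f g : A → ℚ) (xs : List A) →
    sumℚ (map (λ x → f x + g x) xs) ≡ sumℚ (map f xs) + sumℚ (map g xs)
  sumℚ-map-+ f g []       = sym (+-identityˡ 0ℚ)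
  sumℚ-map-+ f g (x ∷ xs) = trans (cong (f x + g x +_) (sumℚ-map-+ f g xs))
                                  (interchange (f x) (g x) _ _)

  sumℚ-map-cong : {f g : A → ℚ} (xs : List A) → (∀ x → f x ≡ g x) →
    sumℚ (map f xs) ≡ sumℚ (map g xs)
  sumℚ-map-cong []       f≗g = refl
  sumℚ-map-cong (x ∷ xs) f≗g = cong₂ _+_ (f≗g x) (sumℚ-map-cong xs f≗g)

  sumℚ-map-mono : {f g : A → ℚ} (xs : List A) → (∀ x → f x ≤ g x) →
    sumℚ (map f xs) ≤ sumℚ (map g xs)
  sumℚ-map-mono []       f≤g = ≤-refl
  sumℚ-map-mono (x ∷ xs) f≤g = +-mono-≤ (f≤g x) (sumℚ-map-mono xs f≤g)

∧-absorbˡ-implied : ∀ {b c} → (b ≡ true → c ≡ true) → c ∧ b ≡ b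
∧-absorbˡ-implied {false} {c} b⇒c = ∧-zeroʳ c
∧-absorbˡ-implied {true}        b⇒c rewrite b⇒c refl = refl

∧-elimˡ : ∀ c {b} → c ∧ b ≡ true → c ≡ true
∧-elimˡ true c∧b = refl

∧-elimʳ : ∀ c {b} → c ∧ b ≡ true → b ≡ true
∧-elimʳ true c∧b = c∧b

if-xor+2*if-∧ : ∀ x y (q : ℚ) →
  (if x xor y then q else 0ℚ) + ((if x ∧ y then q else 0ℚ) + (if x ∧ y then q else 0ℚ))
    ≡ (if x then q else 0ℚ) + (if y then q else 0ℚ)
if-xor+2*if-∧ true  true  q = +-identityˡ (q + q)
if-xor+2*if-∧ true  false q = refl
if-xor+2*if-∧ false true  q = trans (+-identityʳ q) (sym (+-identityˡ q))
if-xor+2*if-∧ false false q = refl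

if-mono : ∀ {x y} {q : ℚ} → (x ≡ true → y ≡ true) → 0ℚ ≤ q →
  (if x then q else 0ℚ) ≤ (if y then q else 0ℚ)
if-mono {false} {false} x⇒y 0≤q = ≤-refl
if-mono {false} {true}  x⇒y 0≤q = 0≤q
if-mono {true}          x⇒y 0≤q rewrite x⇒y refl = ≤-refl

module _ {k : ℕ} {ℓ : Fin k → ℕ} where

  below-branch : ∀ {a c} {t : Fin _} {s : Fin _} → below {k} {ℓ} (a , t) (node c s) ≡ true → a ≡ c
  below-branch {a} {c} h with a ≟ c
  ... | yes a≡c = a≡c

  below-same-branch : ∀ {a b t t′} (u : Vtx k ℓ) →
    below (a , t) u ≡ true → below (b , t′) u ≡ true → a ≡ b
  below-same-branch (node c s) hu hu′ = trans (below-branch hu) (sym (below-branch hu′))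

  below-isCross : ∀ {a b t t′} (u v : Vtx k ℓ) → a ≢ b →
    below (a , t) u ≡ true → below (b , t′) v ≡ true → isCross u v ≡ true
  below-isCross {a} {b} (node c s) (node d s′) a≢b hu hv
    with refl ← below-branch {a} {c} hu | refl ← below-branch {b} {d} hv =
      cong not (trans (isYes≗does (a ≟ b)) (dec-false (a ≟ b) a≢b))

  onPath-both⇒isCross : ∀ {a b t t′} (u v : Vtx k ℓ) → a ≢ b →
    onPath (a , t) u v ≡ true → onPath (b , t′) u v ≡ true → isCross u v ≡ true
  onPath-both⇒isCross {a} {b} {t} {t′} u v a≢b he hf
    with below (a , t) u in eu | below (b , t′) u in fu
  ... | true  | true  = ⊥-elim (a≢b (below-same-branch u eu fu))
  ... | true  | false = below-isCross u v a≢b eu hf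
  ... | false | true  = below-isCross u v (a≢b ∘ sym) fu he
  ... | false | false = ⊥-elim (a≢b (below-same-branch v he hf))

module _ {k : ℕ} {ℓ : Fin k → ℕ} (G : WGraph k ℓ) where
  open WGraph G

  private
    Pred : Set
    Pred = Vtx k ℓ → Vtx k ℓ → Bool

  weightOf-cong : {P Q : Pred} → (∀ u v → P u v ≡ Q u v) → weightOf G P ≡ weightOf G Q
  weightOf-cong P≗Q = sumℚ-map-cong (pairs allVtx)
    (λ (u , v) → cong (λ b → if b then w u v else 0ℚ) (P≗Q u v))

  weightOf-mono : {P Q : Pred} → (∀ u v → P u v ≡ true → Q u v ≡ true) →
    weightOf G P ≤ weightOf G Q
  weightOf-mono P⇒Q = sumℚ-map-mono (pairs allVtx) (λ (u , v) → if-mono (P⇒Q u v) (w-nonneg u v))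

  weightOf-xor : (P Q : Pred) →
    let P∧Q = weightOf G (λ u v → P u v ∧ Q u v) in
    weightOf G (λ u v → P u v xor Q u v) + (P∧Q + P∧Q) ≡ weightOf G P + weightOf G Q
  weightOf-xor P Q = begin
    weightOf G P⊕Q + (weightOf G P∧Q + weightOf G P∧Q)
      ≡⟨ cong (weightOf G P⊕Q +_) (sym (sumℚ-map-+ (term P∧Q) (term P∧Q) xs)) ⟩
    weightOf G P⊕Q + sumℚ (map (λ uv → term P∧Q uv + term P∧Q uv) xs)
      ≡⟨ sym (sumℚ-map-+ (term P⊕Q) (λ uv → term P∧Q uv + term P∧Q uv) xs) ⟩
    sumℚ (map (λ uv → term P⊕Q uv + (term P∧Q uv + term P∧Q uv)) xs)
      ≡⟨ sumℚ-map-cong xs (λ (u , v) → if-xor+2*if-∧ (P u v) (Q u v) (w u v)) ⟩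
    sumℚ (map (λ uv → term P uv + term Q uv) xs)
      ≡⟨ sumℚ-map-+ (term P) (term Q) xs ⟩
    weightOf G P + weightOf G Q ∎
    where
    open ≡-Reasoning
    xs : List (Vtx k ℓ × Vtx k ℓ)
    xs = pairs allVtx
    P⊕Q P∧Q : Pred
    P⊕Q u v = P u v xor Q u v
    P∧Q u v = P u v ∧ Q u v
    term : Pred → Vtx k ℓ × Vtx k ℓ → ℚ
    term R (u , v) = if R u v then w u v else 0ℚ

  CrossCov≤Cut₁ : (e : TEdge k ℓ) → CrossCov G e e ≤ Cut₁ G e
  CrossCov≤Cut₁ e = weightOf-mono (λ u v → ∧-elimʳ (onPath e u v) ∘ ∧-elimʳ (isCross u v))

  CrossCov≡weightOf-onPath-both : ∀ {e f : TEdge k ℓ} → proj₁ e ≢ proj₁ f →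
    CrossCov G e f ≡ weightOf G (λ u v → onPath e u v ∧ onPath f u v)
  CrossCov≡weightOf-onPath-both {e@(a , _)} {f@(b , _)} a≢b = weightOf-cong (λ u v →
    ∧-absorbˡ-implied (λ both →
      onPath-both⇒isCross u v a≢b (∧-elimˡ (onPath e u v) both) (∧-elimʳ (onPath e u v) both)))

  Cut₂+2*CrossCov≡Cut₁+Cut₁ : ∀ {e f : TEdge k ℓ} → proj₁ e ≢ proj₁ f →
    Cut₂ G e f + (CrossCov G e f + CrossCov G e f) ≡ Cut₁ G e + Cut₁ G f
  Cut₂+2*CrossCov≡Cut₁+Cut₁ {e} {f} e≢f =
    trans (cong (λ x → Cut₂ G e f + (x + x)) (CrossCov≡weightOf-onPath-both e≢f))
          (weightOf-xor (onPath e) (onPath f))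

lemma7p3 : (k : ℕ) (ℓ : Fin k → ℕ) (G : WGraph k ℓ) → TreeInGraph G →
    (i j : Fin k) → i ≢ j → (s : Fin (ℓ i)) (t : Fin (ℓ j)) →
    (∀ (g : TEdge k ℓ) → Cut₂ G (pathEdge i s) (pathEdge j t) < Cut₁ G g) →
    ½ * CrossCov G (pathEdge i s) (pathEdge i s) < CrossCov G (pathEdge i s) (pathEdge j t)
lemma7p3 k ℓ G _ i j i≢j s t Cut₂<Cut₁ = ½*p<q CrossCov[e]<X+X
  where
  open ≤-Reasoning
  e f : TEdge k ℓ
  e = pathEdge i s
  f = pathEdge j t
  X : ℚ
  X = CrossCov G e f
  CrossCov[e]<X+X : CrossCov G e e < X + X
  CrossCov[e]<X+X = +-cancelʳ-< (Cut₁ G f) (begin-strict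
    CrossCov G e e + Cut₁ G f  ≤⟨ +-monoˡ-≤ (Cut₁ G f) (CrossCov≤Cut₁ G e) ⟩
    Cut₁ G e + Cut₁ G f        ≡⟨ sym (Cut₂+2*CrossCov≡Cut₁+Cut₁ G i≢j) ⟩
    Cut₂ G e f + (X + X)       <⟨ +-monoˡ-< (X + X) (Cut₂<Cut₁ f) ⟩
    Cut₁ G f + (X + X)         ≡⟨ +-comm (Cut₁ G f) (X + X) ⟩
    (X + X) + Cut₁ G f         ∎)
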